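{- Let $P$ be a finite poset. (a) If $f:P\to Q$ is a surjective $\mathbf{P}$-morphism to a finite poset $Q$, then the set $\mathcal{F}$ of fibers $f^{ -1}(q)$, $q\in Q$, is a partition of $\mathrm{dom}\, f$ satisfying: (1) for all $A,B\in\mathcal{F}$, if $A\le B$ and $B\le A$ then $A=B$; (2) for all $A,B\in\mathcal{F}$ and $a\in A$, if $A\le B$ then there is $b\in B$ with $a\le b$; (3) for every $A\in\mathcal{F}$, the elements of $A$ are pairwise incomparable in $P$. (b) Conversely, if $\mathcal{F}$ is a partition of a subset $P_0\subseteq P$ satisfying (1),(2),(3), then $\le$ is a partial order on $\mathcal{F}$ and the partial map $\pi:P\to\mathcal{F}$ with $\mathrm{dom}\,\pi=P_0$ sending $a$ to the block containing it is a surjective $\mathbf{P}$-morphism whose fibers are exactly the blocks of $\mathcal{F}$. (c) For every surjective $\mathbf{P}$-morphism $f:P\to Q$ between finite posets, with $\mathcal{F}$ its set of fibers, the map $\mathcal{F}\to Q$, $A\mapsto f(A)$, is an isomorphism of posets; thus $f$ coincides, up to this isomorphism, with the projection $\pi$ of (b).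
   Context: For finite posets $P,Q$, a $\mathbf{P}$-morphism $\alpha:P\to Q$ is a partial map with domain $\mathrm{dom}\,\alpha\subseteq P$ such that (i) for $p,q\in\mathrm{dom}\,\alpha$, $p<q$ implies $\alpha(p)<\alpha(q)$, and (ii) for $p\in\mathrm{dom}\,\alpha$ and $q\in Q$ with $\alpha(p)<q$ there is $r\in\mathrm{dom}\,\alpha$ with $p<r$ and $\alpha(r)=q$. It is surjective if every element of $Q$ is in its image. For a partition $\mathcal{F}$ of a subset of $P$ and $A,B\in\mathcal{F}$, write $A\le B$ iff there exist $a\in A$, $b\in B$ with $a\le b$. -}

module Defs where

open import Data.Nat using (ℕ)
open import Data.Fin using (Fin; _≟_)
open import Data.Fin.Subset using (Subset; _∈_)
open import Data.Maybe using (Maybe; just; nothing; is-just)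
open import Data.Bool using (Bool; false)
open import Data.Vec using (tabulate)
open import Data.Product using (Σ; ∃; _×_; _,_)
open import Relation.Nullary using (¬_; does)
open import Relation.Binary.PropositionalEquality using (_≡_)
open import Relation.Binary.Structures using (IsPartialOrder)
open import Function.Bundles using (_⇔_)

record FinPoset : Set₁ where
  constructor mkFinPoset
  field
    size           : ℕ
    _≤_            : Fin size → Fin size → Set
    isPartialOrder : IsPartialOrder _≡_ _≤_

  _<_ : Fin size → Fin size → Set
  p < q = (p ≤ q) × ¬ (p ≡ q)

open FinPoset public

PMap : FinPoset → FinPoset → Set
PMap P Q = Fin (size P) → Maybe (Fin (size Q))

record IsPMorphism (P Q : FinPoset) (α : PMap P Q) : Set where
  field
    strict-mono : ∀ p q x y → α p ≡ just x → α q ≡ just y →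
                  _<_ P p q → _<_ Q x y
    lifting     : ∀ p x q → α p ≡ just x → _<_ Q x q →
                  ∃ λ r → _<_ P p r × α r ≡ just q

Surjective : (P Q : FinPoset) → PMap P Q → Set
Surjective P Q α = ∀ q → ∃ λ p → α p ≡ just q

dom : {P Q : FinPoset} → PMap P Q → Subset (size P)
dom α = tabulate (λ p → is-just (α p))

fiber : {P Q : FinPoset} → PMap P Q → Fin (size Q) → Subset (size P)
fiber α q = tabulate (λ p → test (α p))
  where
  test : Maybe _ → Bool
  test nothing  = false
  test (just x) = does (x ≟ q)

-- A partition of a subset P₀ ⊆ Fin n, given as a family of k blocks
-- (indexed injectively: distinct indices give distinct, disjoint blocks).
record IsPartition {n k : ℕ} (P₀ : Subset n) (B : Fin k → Subset n) : Set where
  field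
    nonempty : ∀ i → ∃ λ a → a ∈ B i
    disjoint : ∀ i j a → a ∈ B i → a ∈ B j → i ≡ j
    covers   : ∀ a → (a ∈ P₀) ⇔ (∃ λ i → a ∈ B i)

BlockLe : (P : FinPoset) {k : ℕ} → (Fin k → Subset (size P)) → Fin k → Fin k → Set
BlockLe P B i j = ∃ λ a → ∃ λ b → a ∈ B i × b ∈ B j × _≤_ P a b

Cond1 : (P : FinPoset) {k : ℕ} → (Fin k → Subset (size P)) → Set
Cond1 P B = ∀ i j → BlockLe P B i j → BlockLe P B j i → i ≡ j

Cond2 : (P : FinPoset) {k : ℕ} → (Fin k → Subset (size P)) → Set
Cond2 P B = ∀ i j a → a ∈ B i → BlockLe P B i j → ∃ λ b → b ∈ B j × _≤_ P a b

-- elements of a block are pairwise incomparable (distinct elements are incomparable)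
Cond3 : (P : FinPoset) {k : ℕ} → (Fin k → Subset (size P)) → Set
Cond3 P B = ∀ i a b → a ∈ B i → b ∈ B i → _≤_ P a b → a ≡ b

-- The fibres of a surjective P-morphism f : P → Q are blocks whose induced order is
-- exactly the order of Q: strict monotonicity turns comparabilities between fibres
-- into comparabilities in Q (and forbids comparabilities inside a fibre), while the
-- lifting property turns q ≤ q' back into comparabilities above every point of f⁻¹(q).
-- Conversely, for a partition with (1)–(3), condition (2) makes the block order
-- transitive and (1) antisymmetric, (3) makes the block projection strictly monotone,
-- and (2) supplies the lifting property, the lift being strict since blocks are disjoint.
module Submission where

open import Defs
open import Data.Nat using (ℕ)
open import Data.Bool using (Bool; true; false)
open import Data.Fin using (Fin; _≟_)
open import Data.Fin.Properties using (any?)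
open import Data.Fin.Subset using (Subset; _∈_)
open import Data.Fin.Subset.Properties using (_∈?_)
open import Data.Maybe using (Maybe; just; map; is-just)
open import Data.Maybe.Properties using (just-injective)
open import Data.Product using (Σ; ∃; _×_; _,_; proj₁; proj₂)
open import Data.Vec using (tabulate; lookup)
open import Data.Vec.Properties using (lookup∘tabulate; []=⇒lookup; lookup⇒[]=)
open import Data.Empty using (⊥-elim)
open import Function.Base using (_∘_)
open import Function.Bundles using (_⇔_; _↔_; mk⇔; Equivalence)
open import Function.Construct.Identity using (↔-id)
open import Relation.Nullary using (yes; no)
open import Relation.Nullary.Decidable using (dec-true; dec⇒maybe)
open import Relation.Binary.Definitions using (Reflexive; Transitive)
open import Relation.Binary.PropositionalEquality
  using (_≡_; refl; sym; trans; cong; subst; isEquivalence)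
open import Relation.Binary.Structures using (IsPartialOrder)

∈-tabulate⁻ : ∀ {n} {g : Fin n → Bool} {a} → a ∈ tabulate g → g a ≡ true
∈-tabulate⁻ {g = g} {a} a∈ = trans (sym (lookup∘tabulate g a)) ([]=⇒lookup a∈)

∈-tabulate⁺ : ∀ {n} {g : Fin n → Bool} {a} → g a ≡ true → a ∈ tabulate g
∈-tabulate⁺ {g = g} {a} ga = lookup⇒[]= a _ (trans (lookup∘tabulate g a) ga)

module FiberMembership (P Q : FinPoset) (f : PMap P Q) where

  ∈-fiber⁻ : ∀ {q a} → a ∈ fiber {P} {Q} f q → f a ≡ just q
  ∈-fiber⁻ {q} {a} a∈ with f a | ∈-tabulate⁻ a∈
  ... | just x | _ with x ≟ q
  ...   | yes refl = refl
  ∈-fiber⁻ a∈ | just x | () | no _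

  -- The Boolean test inside fiber is local to Defs, so instead of ∈-tabulate⁺ we
  -- compute the bit of fiber f q at a directly.
  ∈-fiber⁺ : ∀ {q a} → f a ≡ just q → a ∈ fiber {P} {Q} f q
  ∈-fiber⁺ {q} {a} fa≡q with lookup (fiber {P} {Q} f q) a in a∈
  ... | true  = lookup⇒[]= a _ a∈
  ... | false with f a | fa≡q | trans (sym (lookup∘tabulate _ a)) a∈
  ...   | just .q | refl | q≟q≡false with () ← trans (sym (dec-true (q ≟ q) refl)) q≟q≡false

  ∈-dom⁻ : ∀ {a} → a ∈ dom {P} {Q} f → ∃ λ q → f a ≡ just q
  ∈-dom⁻ {a} a∈ with f a | ∈-tabulate⁻ a∈
  ... | just q | _ = q , refl

  ∈-dom⁺ : ∀ {q a} → f a ≡ just q → a ∈ dom {P} {Q} f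
  ∈-dom⁺ fa≡q = ∈-tabulate⁺ (cong is-just fa≡q)

  fiber-disjoint : ∀ i j a → a ∈ fiber {P} {Q} f i → a ∈ fiber {P} {Q} f j → i ≡ j
  fiber-disjoint i j a a∈i a∈j = just-injective (trans (sym (∈-fiber⁻ a∈i)) (∈-fiber⁻ a∈j))

module _ {P Q : FinPoset} {f : PMap P Q} (f-isPMorphism : IsPMorphism P Q f) where
  open IsPMorphism f-isPMorphism
  open FiberMembership P Q f
  private
    module P = IsPartialOrder (isPartialOrder P)
    module Q = IsPartialOrder (isPartialOrder Q)

  fiber-blockLe⇒≤ : ∀ {i j} → BlockLe P (fiber {P} {Q} f) i j → _≤_ Q i j
  fiber-blockLe⇒≤ {i} {j} (a , b , a∈i , b∈j , a≤b) with a ≟ b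
  ... | yes refl = Q.reflexive (fiber-disjoint i j a a∈i b∈j)
  ... | no a≢b   = proj₁ (strict-mono a b i j (∈-fiber⁻ a∈i) (∈-fiber⁻ b∈j) (a≤b , a≢b))

  fiber-lift : ∀ {i j a} → a ∈ fiber {P} {Q} f i → _≤_ Q i j →
               ∃ λ b → b ∈ fiber {P} {Q} f j × _≤_ P a b
  fiber-lift {i} {j} {a} a∈i i≤j with i ≟ j
  ... | yes refl = a , a∈i , P.refl
  ... | no i≢j with lifting a i j (∈-fiber⁻ a∈i) (i≤j , i≢j)
  ...   | b , (a≤b , _) , fb≡j = b , ∈-fiber⁺ fb≡j , a≤b

  fiber-cond1 : Cond1 P (fiber {P} {Q} f)
  fiber-cond1 i j i≤j j≤i = Q.antisym (fiber-blockLe⇒≤ i≤j) (fiber-blockLe⇒≤ j≤i)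

  fiber-cond2 : Cond2 P (fiber {P} {Q} f)
  fiber-cond2 i j a a∈i i≤j = fiber-lift a∈i (fiber-blockLe⇒≤ i≤j)

  fiber-cond3 : Cond3 P (fiber {P} {Q} f)
  fiber-cond3 i a b a∈i b∈i a≤b with a ≟ b
  ... | yes a≡b = a≡b
  ... | no a≢b  =
    ⊥-elim (proj₂ (strict-mono a b i i (∈-fiber⁻ a∈i) (∈-fiber⁻ b∈i) (a≤b , a≢b)) refl)

  module _ (f-surjective : Surjective P Q f) where

    ≤⇒fiber-blockLe : ∀ {i j} → _≤_ Q i j → BlockLe P (fiber {P} {Q} f) i j
    ≤⇒fiber-blockLe {i} i≤j =
      let (a , fa≡i) = f-surjective i
          (b , b∈j , a≤b) = fiber-lift (∈-fiber⁺ fa≡i) i≤j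
      in a , b , ∈-fiber⁺ fa≡i , b∈j , a≤b

    fiber-blockLe⇔≤ : ∀ i j → BlockLe P (fiber {P} {Q} f) i j ⇔ _≤_ Q i j
    fiber-blockLe⇔≤ i j = mk⇔ fiber-blockLe⇒≤ ≤⇒fiber-blockLe

    fiber-isPartition : IsPartition (dom {P} {Q} f) (fiber {P} {Q} f)
    fiber-isPartition = record
      { nonempty = λ i → let (a , fa≡i) = f-surjective i in a , ∈-fiber⁺ fa≡i
      ; disjoint = fiber-disjoint
      ; covers   = λ a → mk⇔ (λ a∈ → let (i , fa≡i) = ∈-dom⁻ a∈ in i , ∈-fiber⁺ fa≡i)
                              (λ (i , a∈i) → ∈-dom⁺ (∈-fiber⁻ a∈i))
      }

module _ (P : FinPoset) {k : ℕ} {B : Fin k → Subset (size P)} where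
  private
    module P = IsPartialOrder (isPartialOrder P)

  blockLe-refl : (∀ i → ∃ λ a → a ∈ B i) → Reflexive (BlockLe P B)
  blockLe-refl nonempty {i} = let (a , a∈i) = nonempty i in a , a , a∈i , a∈i , P.refl

  blockLe-trans : Cond2 P B → Transitive (BlockLe P B)
  blockLe-trans cond2 {j = j} {l} (a , b , a∈i , b∈j , a≤b) j≤l =
    let (c , c∈l , b≤c) = cond2 j l b b∈j j≤l in a , c , a∈i , c∈l , P.trans a≤b b≤c

  blockLe-isPartialOrder : ∀ {P₀} → IsPartition P₀ B → Cond1 P B → Cond2 P B →
                           IsPartialOrder _≡_ (BlockLe P B)
  blockLe-isPartialOrder B-isPartition cond1 cond2 = record
    { isPreorder = record
      { isEquivalence = isEquivalence
      ; reflexive     = λ { refl → blockLe-refl (IsPartition.nonempty B-isPartition) }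
      ; trans         = blockLe-trans cond2
      }
    ; antisym = cond1 _ _
    }

blockOf : ∀ {n k} → (Fin k → Subset n) → Fin n → Maybe (Fin k)
blockOf B a = map proj₁ (dec⇒maybe (any? λ i → a ∈? B i))

module _ {n k : ℕ} {B : Fin k → Subset n} where

  blockOf-sound : ∀ {a i} → blockOf B a ≡ just i → a ∈ B i
  blockOf-sound {a} with any? (λ i → a ∈? B i)
  ... | yes (i , a∈i) = λ { refl → a∈i }

  blockOf-complete : (∀ i j a → a ∈ B i → a ∈ B j → i ≡ j) →
                     ∀ {a i} → a ∈ B i → blockOf B a ≡ just i
  blockOf-complete disjoint {a} {i} a∈i with any? (λ j → a ∈? B j)
  ... | yes (j , a∈j) = cong just (disjoint j i a a∈j a∈i)
  ... | no a∉B        = ⊥-elim (a∉B (i , a∈i))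

module BlockProjection (P : FinPoset) {P₀ : Subset (size P)} {k : ℕ} {B : Fin k → Subset (size P)}
                       (B-isPartition : IsPartition P₀ B)
                       (cond1 : Cond1 P B) (cond2 : Cond2 P B) (cond3 : Cond3 P B) where
  open IsPartition B-isPartition

  blockPoset : FinPoset
  blockPoset = mkFinPoset k (BlockLe P B) (blockLe-isPartialOrder P B-isPartition cond1 cond2)

  open FiberMembership P blockPoset (blockOf B)

  blockOf⇔∈ : ∀ a i → (blockOf B a ≡ just i) ⇔ (a ∈ B i)
  blockOf⇔∈ a i = mk⇔ blockOf-sound (blockOf-complete disjoint)

  ∈-dom-blockOf⇔ : ∀ a → (a ∈ dom {P} {blockPoset} (blockOf B)) ⇔ (a ∈ P₀)
  ∈-dom-blockOf⇔ a = mk⇔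
    (λ a∈ → let (i , a∈i) = ∈-dom⁻ a∈ in Equivalence.from (covers a) (i , blockOf-sound a∈i))
    (λ a∈ → let (i , a∈i) = Equivalence.to (covers a) a∈ in ∈-dom⁺ (blockOf-complete disjoint a∈i))

  ∈-fiber-blockOf⇔ : ∀ i a → (a ∈ fiber {P} {blockPoset} (blockOf B) i) ⇔ (a ∈ B i)
  ∈-fiber-blockOf⇔ i a = mk⇔ (blockOf-sound ∘ ∈-fiber⁻) (∈-fiber⁺ ∘ blockOf-complete disjoint)

  blockOf-surjective : Surjective P blockPoset (blockOf B)
  blockOf-surjective i = let (a , a∈i) = nonempty i in a , blockOf-complete disjoint a∈i

  blockOf-isPMorphism : IsPMorphism P blockPoset (blockOf B)
  blockOf-isPMorphism = record
    { strict-mono = λ a b i j a↦i b↦j (a≤b , a≢b) →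
        let a∈i = blockOf-sound a↦i ; b∈j = blockOf-sound b↦j in
        (a , b , a∈i , b∈j , a≤b) , λ { refl → a≢b (cond3 i a b a∈i b∈j a≤b) }
    ; lifting = λ a i j a↦i (i≤j , i≢j) →
        let a∈i = blockOf-sound a↦i ; (b , b∈j , a≤b) = cond2 i j a a∈i i≤j in
        b , (a≤b , λ a≡b → i≢j (disjoint i j a a∈i (subst (_∈ B j) (sym a≡b) b∈j)))
          , blockOf-complete disjoint b∈j
    }

proposition3p2 :
    (∀ (P Q : FinPoset) (f : PMap P Q) → IsPMorphism P Q f → Surjective P Q f →
       IsPartition (dom {P} {Q} f) (fiber {P} {Q} f)
       × Cond1 P (fiber {P} {Q} f)
       × Cond2 P (fiber {P} {Q} f)
       × Cond3 P (fiber {P} {Q} f))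
    ×
    (∀ (P : FinPoset) (P₀ : Subset (size P)) (k : ℕ) (B : Fin k → Subset (size P)) →
       IsPartition P₀ B → Cond1 P B → Cond2 P B → Cond3 P B →
       Σ (IsPartialOrder _≡_ (BlockLe P B)) λ po →
         let F = mkFinPoset k (BlockLe P B) po in
         Σ (PMap P F) λ π →
           (∀ a i → (π a ≡ just i) ⇔ (a ∈ B i))
           × (∀ a → (a ∈ dom {P} {F} π) ⇔ (a ∈ P₀))
           × IsPMorphism P F π
           × Surjective P F π
           × (∀ i a → (a ∈ fiber {P} {F} π i) ⇔ (a ∈ B i)))
    ×
    (∀ (P Q : FinPoset) (f : PMap P Q) → IsPMorphism P Q f → Surjective P Q f →
       Σ (Fin (size Q) ↔ Fin (size Q)) λ φ →
         let open Function.Bundles.Inverse φ using (to) in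
         (∀ i a → a ∈ fiber {P} {Q} f i → f a ≡ just (to i))
         × (∀ i j → BlockLe P (fiber {P} {Q} f) i j ⇔ _≤_ Q (to i) (to j)))
proposition3p2 =
    (λ P Q f f-mor f-surj →
       fiber-isPartition f-mor f-surj , fiber-cond1 f-mor , fiber-cond2 f-mor , fiber-cond3 f-mor)
  , (λ P P₀ k B B-part cond1 cond2 cond3 →
       let open BlockProjection P B-part cond1 cond2 cond3 in
       blockLe-isPartialOrder P B-part cond1 cond2 , blockOf B , blockOf⇔∈ , ∈-dom-blockOf⇔
       , blockOf-isPMorphism , blockOf-surjective , ∈-fiber-blockOf⇔)
    -- The fibres are indexed by the points of Q, so the isomorphism is the identity.
  , (λ P Q f f-mor f-surj →
       ↔-id _ , (λ i a → FiberMembership.∈-fiber⁻ P Q f) , fiber-blockLe⇔≤ f-mor f-surj)
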